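{- Let $k\ge 1$ be an integer and let $X$, $Y$ be strings of lengths $m$ and $n$. For $0\le i\le m$, $0\le j\le n$, let $C[i,j]$ be the length of an LCS$_{k^+}$ of the prefixes $X[1:i]$ and $Y[1:j]$; let $L[i,j]=\max\{l\ge 0 : X[i-l+1:i]=Y[j-l+1:j]\}$ (the length of the longest common suffix of $X[1:i]$ and $Y[1:j]$); and let $M[i,j]=\max_{k\le l\le L[i,j]}\{C[i-l,j-l]+l\}$ if $L[i,j]\ge k$, and $M[i,j]=-1$ otherwise. Then for any $0\le i\le m$ and $0\le j\le n$, if $L[i,j]>k$ then $M[i,j]=\max\{M[i-1,j-1]+1,\ C[i-k,j-k]+k\}$.
   Context: For a string $X$, $X[i:j]=X[i]\cdots X[j]$ (empty if $j<i$), and $X[i..l]:=X[i:i+l-1]$. Given strings $X,Y$ and integer $k\ge1$, a string $Z$ is a common subsequence in at least $k$ length substrings of $X$ and $Y$ if there exist $t\ge 0$, indices $i_1,\dots,i_t$, $j_1,\dots,j_t$, $p_1,\dots,p_t$ and lengths $l_1,\dots,l_t$ with $l_s\ge k$ and $X[i_s..l_s]=Y[j_s..l_s]=Z[p_s..l_s]$ for all $s$, $i_s+l_s\le i_{s+1}$, $j_s+l_s\le j_{s+1}$, $p_{s+1}=p_s+l_s$ for $1\le s<t$, $p_1=1$ and $|Z|=p_t+l_t-1$. An LCS$_{k^+}$ is such a $Z$ of maximum length. -}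

module Defs where

open import Data.Nat using (ℕ; zero; suc; _+_; _∸_; _≤_; _⊔_; _≤?_)
open import Data.Integer using (ℤ; +_; -[1+_])
open import Data.List using (List; []; _∷_; length; take; drop)
open import Data.List.Relation.Unary.All using (All)
open import Data.List.Relation.Unary.Linked using (Linked)
open import Data.Product using (Σ; _×_)
open import Data.Unit using (⊤)
open import Relation.Binary.PropositionalEquality using (_≡_)
open import Relation.Nullary using (yes; no)

-- 1-based substring  X[i..l] = X[i : i+l-1]
sub : {A : Set} → List A → ℕ → ℕ → List A
sub X i l = take l (drop (i ∸ 1) X)

InRange : {A : Set} → List A → ℕ → ℕ → Set
InRange X i l = (1 ≤ i) × (i + l ∸ 1 ≤ length X)

-- one matched block s : (i_s, j_s, p_s, l_s)
record Block : Set where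
  constructor blk
  field
    bi bj bp bl : ℕ
open Block public

BlockOK : {A : Set} → ℕ → List A → List A → List A → Block → Set
BlockOK k X Y Z b =
  (k ≤ bl b) ×
  InRange X (bi b) (bl b) × InRange Y (bj b) (bl b) × InRange Z (bp b) (bl b) ×
  (sub X (bi b) (bl b) ≡ sub Y (bj b) (bl b)) ×
  (sub Y (bj b) (bl b) ≡ sub Z (bp b) (bl b))

Next : Block → Block → Set
Next b b' = (bi b + bl b ≤ bi b') × (bj b + bl b ≤ bj b') × (bp b' ≡ bp b + bl b)

FirstOK : List Block → Set
FirstOK []      = ⊤
FirstOK (b ∷ _) = bp b ≡ 1

LastOK : List Block → ℕ → Set
LastOK []           z = z ≡ 0
LastOK (b ∷ [])     z = z ≡ bp b + bl b ∸ 1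
LastOK (_ ∷ b ∷ bs) z = LastOK (b ∷ bs) z

-- Z is a common subsequence in at least k length substrings of X and Y
CSk : {A : Set} → ℕ → List A → List A → List A → Set
CSk k X Y Z = Σ (List Block) λ bs →
  All (BlockOK k X Y Z) bs × Linked Next bs × FirstOK bs × LastOK bs (length Z)

IsLCSkLength : {A : Set} → ℕ → List A → List A → ℕ → Set
IsLCSkLength {A} k X Y c =
  (Σ (List A) λ Z → CSk k X Y Z × length Z ≡ c) ×
  ((Z : List A) → CSk k X Y Z → length Z ≤ c)

CommonSuffix : {A : Set} → List A → List A → ℕ → ℕ → ℕ → Set
CommonSuffix X Y i j l = (l ≤ i) × (l ≤ j) × (sub X (i ∸ l + 1) l ≡ sub Y (j ∸ l + 1) l)

IsLCSuffixLength : {A : Set} → List A → List A → ℕ → ℕ → ℕ → Set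
IsLCSuffixLength X Y i j L =
  CommonSuffix X Y i j L × ((l : ℕ) → CommonSuffix X Y i j l → l ≤ L)

maxFrom : (ℕ → ℕ) → ℕ → ℕ → ℕ
maxFrom f a zero    = f a
maxFrom f a (suc d) = f a ⊔ maxFrom f (suc a) d

-- max_{a ≤ l ≤ b} f l   (used only with a ≤ b)
maxRange : (ℕ → ℕ) → ℕ → ℕ → ℕ
maxRange f a b = maxFrom f a (b ∸ a)

Mtab : (C L : ℕ → ℕ → ℕ) → ℕ → ℕ → ℕ → ℤ
Mtab C L k i j with k ≤? L i j
... | yes _ = + maxRange (λ l → C (i ∸ l) (j ∸ l) + l) k (L i j)
... | no  _ = -[1+ 0 ]

-- A common suffix of X[1:i+1] and Y[1:j+1] of positive length l+1 is exactly a common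
-- suffix of X[1:i] and Y[1:j] of length l extended by the equal symbols X[i+1] = Y[j+1].
-- Hence L[i,j] = N+1 forces L[i-1,j-1] = N, and re-indexing l ↦ l+1 turns the terms
-- l = k+1 .. N+1 of M[i,j] into the terms l = k .. N of M[i-1,j-1], each raised by one;
-- only the term l = k of M[i,j] is left over. No property of C is needed.
module Submission where

open import Defs
open import Data.Nat using (ℕ; zero; suc; _+_; _∸_; _≤_; _<_; _≤?_; z≤n; s≤s; s≤s⁻¹; pred; >-nonZero)
  renaming (_⊔_ to _⊔ℕ_)
open import Data.Nat.Properties
open import Data.Integer using (+_; _⊔_) renaming (_+_ to _+ℤ_)
open import Data.List using (List; []; _∷_; length; take; drop; _++_)
open import Data.List.Properties using (take-take; drop-drop)
open import Data.Product using (_,_; proj₁; proj₂)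
open import Relation.Binary.PropositionalEquality
  using (_≡_; refl; sym; trans; cong; cong₂; subst; module ≡-Reasoning)
open import Relation.Nullary using (yes; no; contradiction)

module _ {A : Set} where

  take-suc-++ : ∀ l (xs : List A) → take (suc l) xs ≡ take l xs ++ take 1 (drop l xs)
  take-suc-++ zero    xs       = refl
  take-suc-++ (suc l) []       = refl
  take-suc-++ (suc l) (x ∷ xs) = cong (x ∷_) (take-suc-++ l xs)

  take-take-suc : ∀ l (xs : List A) → take l (take (suc l) xs) ≡ take l xs
  take-take-suc l xs = trans (take-take l (suc l) xs) (cong (λ n → take n xs) (m≤n⇒m⊓n≡m (n≤1+n l)))

  drop-take-suc : ∀ l (xs : List A) → drop l (take (suc l) xs) ≡ take 1 (drop l xs)
  drop-take-suc zero    xs       = refl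
  drop-take-suc (suc l) []       = refl
  drop-take-suc (suc l) (x ∷ xs) = drop-take-suc l xs

  -- The suffix of length l of X[1:i]; 0-based, so X[i-l+1 .. i] starts at index i ∸ l.
  suffix : List A → ℕ → ℕ → List A
  suffix X i l = take l (drop (i ∸ l) X)

  -- The last symbol X[i+1] of X[1:i+1], as a list of length at most one.
  lastOf : List A → ℕ → List A
  lastOf X i = take 1 (drop i X)

  sub≡suffix : ∀ X i l → sub X (i ∸ l + 1) l ≡ suffix X i l
  sub≡suffix X i l = cong (λ n → take l (drop n X)) (m+n∸n≡m (i ∸ l) 1)

  drop-drop-∸ : ∀ (X : List A) {i l} → l ≤ i → drop l (drop (i ∸ l) X) ≡ drop i X
  drop-drop-∸ X {i} {l} l≤i = trans (drop-drop (i ∸ l) l X) (cong (λ n → drop n X) (m∸n+n≡m l≤i))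

  suffix-suc : ∀ X {i l} → l ≤ i → suffix X (suc i) (suc l) ≡ suffix X i l ++ lastOf X i
  suffix-suc X {i} {l} l≤i = trans (take-suc-++ l (drop (i ∸ l) X))
    (cong (λ xs → suffix X i l ++ take 1 xs) (drop-drop-∸ X l≤i))

  suffix-init : ∀ X i l → take l (suffix X (suc i) (suc l)) ≡ suffix X i l
  suffix-init X i l = take-take-suc l (drop (i ∸ l) X)

  suffix-last : ∀ X {i l} → l ≤ i → drop l (suffix X (suc i) (suc l)) ≡ lastOf X i
  suffix-last X {i} {l} l≤i =
    trans (drop-take-suc l (drop (i ∸ l) X)) (cong (take 1) (drop-drop-∸ X l≤i))

  module _ (X Y : List A) where

    commonSuffix-≡ : ∀ {i j l} → CommonSuffix X Y i j l → suffix X i l ≡ suffix Y j l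
    commonSuffix-≡ {i} {j} {l} (_ , _ , eq) =
      trans (sym (sub≡suffix X i l)) (trans eq (sub≡suffix Y j l))

    commonSuffix : ∀ {i j l} → l ≤ i → l ≤ j → suffix X i l ≡ suffix Y j l → CommonSuffix X Y i j l
    commonSuffix {i} {j} {l} l≤i l≤j eq =
      l≤i , l≤j , trans (sub≡suffix X i l) (trans eq (sym (sub≡suffix Y j l)))

    commonSuffix-init : ∀ {i j l} → CommonSuffix X Y (suc i) (suc j) (suc l) →
                        CommonSuffix X Y i j l
    commonSuffix-init {i} {j} {l} cs@(s≤s l≤i , s≤s l≤j , _) = commonSuffix l≤i l≤j (begin
      suffix X i l                      ≡˘⟨ suffix-init X i l ⟩
      take l (suffix X (suc i) (suc l)) ≡⟨ cong (take l) (commonSuffix-≡ cs) ⟩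
      take l (suffix Y (suc j) (suc l)) ≡⟨ suffix-init Y j l ⟩
      suffix Y j l                      ∎)
      where open ≡-Reasoning

    commonSuffix-last : ∀ {i j l} → CommonSuffix X Y (suc i) (suc j) (suc l) →
                        lastOf X i ≡ lastOf Y j
    commonSuffix-last {i} {j} {l} cs@(s≤s l≤i , s≤s l≤j , _) = begin
      lastOf X i                        ≡˘⟨ suffix-last X l≤i ⟩
      drop l (suffix X (suc i) (suc l)) ≡⟨ cong (drop l) (commonSuffix-≡ cs) ⟩
      drop l (suffix Y (suc j) (suc l)) ≡⟨ suffix-last Y l≤j ⟩
      lastOf Y j                        ∎
      where open ≡-Reasoning

    commonSuffix-snoc : ∀ {i j l} → lastOf X i ≡ lastOf Y j → CommonSuffix X Y i j l →
                        CommonSuffix X Y (suc i) (suc j) (suc l)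
    commonSuffix-snoc {i} {j} {l} last≡ cs@(l≤i , l≤j , _) = commonSuffix (s≤s l≤i) (s≤s l≤j) (begin
      suffix X (suc i) (suc l)   ≡⟨ suffix-suc X l≤i ⟩
      suffix X i l ++ lastOf X i ≡⟨ cong₂ _++_ (commonSuffix-≡ cs) last≡ ⟩
      suffix Y j l ++ lastOf Y j ≡˘⟨ suffix-suc Y l≤j ⟩
      suffix Y (suc j) (suc l)   ∎)
      where open ≡-Reasoning

    isLCSuffixLength-pred : ∀ {i j N M} → IsLCSuffixLength X Y (suc i) (suc j) (suc N) →
                            IsLCSuffixLength X Y i j M → M ≡ N
    isLCSuffixLength-pred (cs , longest) (cs′ , longest′) = ≤-antisym
      (s≤s⁻¹ (longest _ (commonSuffix-snoc (commonSuffix-last cs) cs′)))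
      (longest′ _ (commonSuffix-init cs))

maxFrom-shift : (f g : ℕ → ℕ) → (∀ a → f (suc a) ≡ g a + 1) →
                ∀ a d → maxFrom f (suc a) d ≡ maxFrom g a d + 1
maxFrom-shift f g f∘suc≡g+1 a zero    = f∘suc≡g+1 a
maxFrom-shift f g f∘suc≡g+1 a (suc d) = trans
  (cong₂ _⊔ℕ_ (f∘suc≡g+1 a) (maxFrom-shift f g f∘suc≡g+1 (suc a) d))
  (sym (+-distribʳ-⊔ 1 (g a) (maxFrom g (suc a) d)))

maxRange-suc : (f : ℕ → ℕ) → ∀ {a b} → a ≤ b → maxRange f a (suc b) ≡ f a ⊔ℕ maxFrom f (suc a) (b ∸ a)
maxRange-suc f {a} a≤b = cong (maxFrom f a) (+-∸-assoc 1 a≤b)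

module _ (C L : ℕ → ℕ → ℕ) (k : ℕ) where

  Mtab-defined : ∀ {i j} → k ≤ L i j →
                 Mtab C L k i j ≡ + maxRange (λ l → C (i ∸ l) (j ∸ l) + l) k (L i j)
  Mtab-defined {i} {j} k≤L with k ≤? L i j
  ... | yes _   = refl
  ... | no  k≰L = contradiction k≤L k≰L

  Mtab-suc : ∀ {i j N} → L (suc i) (suc j) ≡ suc N → L i j ≡ N → k ≤ N →
             Mtab C L k (suc i) (suc j) ≡ (Mtab C L k i j +ℤ + 1) ⊔ (+ (C (suc i ∸ k) (suc j ∸ k) + k))
  Mtab-suc {i} {j} {N} L′≡1+N L≡N k≤N = begin
    Mtab C L k (suc i) (suc j)                   ≡⟨ Mtab-defined k≤L′ ⟩
    + maxRange f k (L (suc i) (suc j))           ≡⟨ cong (λ n → + maxRange f k n) L′≡1+N ⟩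
    + maxRange f k (suc N)                       ≡⟨ cong +_ (maxRange-suc f k≤N) ⟩
    + (f k ⊔ℕ maxFrom f (suc k) (N ∸ k))         ≡⟨ cong (λ n → + (f k ⊔ℕ n)) (maxFrom-shift f g f∘suc≡g+1 k (N ∸ k)) ⟩
    + (f k ⊔ℕ (maxRange g k N + 1))              ≡⟨ cong +_ (⊔-comm (f k) _) ⟩
    (+ maxRange g k N +ℤ + 1) ⊔ (+ f k)          ≡˘⟨ cong (λ n → (+ maxRange g k n +ℤ + 1) ⊔ (+ f k)) L≡N ⟩
    (+ maxRange g k (L i j) +ℤ + 1) ⊔ (+ f k)    ≡˘⟨ cong (λ m → (m +ℤ + 1) ⊔ (+ f k)) (Mtab-defined k≤L) ⟩
    (Mtab C L k i j +ℤ + 1) ⊔ (+ f k)            ∎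
    where
    open ≡-Reasoning
    k≤L′ : k ≤ L (suc i) (suc j)
    k≤L′ = subst (k ≤_) (sym L′≡1+N) (m≤n⇒m≤1+n k≤N)
    k≤L : k ≤ L i j
    k≤L = subst (k ≤_) (sym L≡N) k≤N
    f g : ℕ → ℕ
    f l = C (suc i ∸ l) (suc j ∸ l) + l
    g l = C (i ∸ l) (j ∸ l) + l
    f∘suc≡g+1 : ∀ l → f (suc l) ≡ g l + 1
    f∘suc≡g+1 l = trans (+-suc _ l) (+-comm 1 (g l))

lemma2 : {A : Set} (k : ℕ) → 1 ≤ k → (X Y : List A) → (C L : ℕ → ℕ → ℕ) →
         ((i j : ℕ) → i ≤ length X → j ≤ length Y → IsLCSkLength k (take i X) (take j Y) (C i j)) →
         ((i j : ℕ) → i ≤ length X → j ≤ length Y → IsLCSuffixLength X Y i j (L i j)) →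
         (i j : ℕ) → i ≤ length X → j ≤ length Y → k < L i j →
         Mtab C L k i j ≡ (Mtab C L k (i ∸ 1) (j ∸ 1) +ℤ + 1) ⊔ (+ (C (i ∸ k) (j ∸ k) + k))
lemma2 k _ X Y C L _ isL zero j i≤m j≤n k<L =
  contradiction (<-≤-trans k<L (proj₁ (proj₁ (isL zero j i≤m j≤n)))) n≮0
lemma2 k _ X Y C L _ isL (suc i) zero i≤m j≤n k<L =
  contradiction (<-≤-trans k<L (proj₁ (proj₂ (proj₁ (isL (suc i) zero i≤m j≤n))))) n≮0
lemma2 k _ X Y C L _ isL (suc i) (suc j) i≤m j≤n k<L = Mtab-suc C L k L′≡1+N L≡N (<⇒≤pred k<L)
  where
  N : ℕ
  N = pred (L (suc i) (suc j))
  L′≡1+N : L (suc i) (suc j) ≡ suc N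
  L′≡1+N = sym (suc-pred _ {{>-nonZero (≤-<-trans z≤n k<L)}})
  L≡N : L i j ≡ N
  L≡N = isLCSuffixLength-pred X Y
          (subst (IsLCSuffixLength X Y (suc i) (suc j)) L′≡1+N (isL (suc i) (suc j) i≤m j≤n))
          (isL i j (<⇒≤ i≤m) (<⇒≤ j≤n))
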